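{- Let $G=(V,E)$ be a finite, simple, connected graph, let $\mathcal{F}$ be a maximum induced forest of $G$, let $\mathcal{T}$ be the set of connected components (trees) of $\mathcal{F}$, and let $S = V \setminus V(\mathcal{F})$. Let $H$ be the graph with vertex set $\{x_T : T \in \mathcal{T}\} \cup S$ and edge set consisting of all edges of $G[S]$ together with all pairs $u x_T$ with $u \in S$, $T \in \mathcal{T}$ such that $u$ has at least one edge to $V(T)$ in $G$. Call an edge $u x_T$ of $H$ (with $u\in S$, $T\in\mathcal{T}$) a 2-edge if $u$ has at least two edges to $V(T)$ in $G$; all other edges of $H$ are 1-edges. Let $B$ be a spanning tree of $H$ (with a vertex $x_T$ chosen as root and all edges directed towards the root) such that the number of 2-edges in $B$ is as large as possible among all spanning trees of $H$. Then every vertex in $S$ is incident in $B$ to at least one 2-edge.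
   Context: A maximum induced forest of $G$ is an induced subgraph of $G$ that is a forest and has the largest possible number of vertices. $G[S]$ denotes the subgraph induced by $S$. -}

module Defs where

open import Data.Nat using (ℕ; zero; suc; _+_; _≤_; _≤?_)
open import Data.Bool using (Bool; true; false; if_then_else_; _∧_)
open import Data.Fin using (Fin; zero; suc) renaming (_≟_ to _≟ᶠ_)
open import Data.Fin.Subset using (Subset; _∈_; _∉_; ∣_∣)
open import Data.Fin.Subset.Properties using (_∈?_)
open import Data.List using (List; []; _∷_; _++_; length)
open import Data.List.Relation.Unary.All using (All)
open import Data.List.Relation.Unary.Linked using (Linked)
open import Data.List.Relation.Unary.Unique.Propositional using (Unique)
open import Data.Product using (Σ; ∃; _×_; _,_)
open import Data.Sum using (_⊎_; inj₁; inj₂)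
open import Data.Empty using (⊥)
open import Data.Unit using (⊤)
open import Relation.Nullary using (¬_)
open import Relation.Nullary.Decidable using (⌊_⌋)
open import Relation.Binary using (Decidable)
open import Relation.Binary.PropositionalEquality using (_≡_)

record Graph (n : ℕ) : Set₁ where
  field
    Adj    : Fin n → Fin n → Set
    adj?   : Decidable Adj
    sym    : ∀ {u v} → Adj u v → Adj v u
    irrefl : ∀ {u} → ¬ Adj u u
open Graph public

data Walk {V : Set} (P : V → Set) (R : V → V → Set) : V → V → Set where
  here : ∀ {v} → P v → Walk P R v v
  step : ∀ {u v w} → P u → R u v → Walk P R v w → Walk P R u w

IsConnected : {V : Set} (P : V → Set) (R : V → V → Set) → Set
IsConnected P R = ∀ u v → P u → P v → Walk P R u v

-- a cycle v, v1, ..., vr, v with r ≥ 2 (so length ≥ 3) and distinct vertices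
record Cycle {V : Set} (P : V → Set) (R : V → V → Set) : Set where
  field
    start    : V
    rest     : List V
    long     : 2 ≤ length rest
    distinct : Unique (start ∷ rest)
    inside   : All P (start ∷ rest)
    closed   : Linked R (start ∷ rest ++ start ∷ [])

IsAcyclic : {V : Set} (P : V → Set) (R : V → V → Set) → Set
IsAcyclic P R = ¬ Cycle P R

IsTree : {V : Set} (P : V → Set) (R : V → V → Set) → Set
IsTree P R = IsConnected P R × IsAcyclic P R

module _ {n : ℕ} (G : Graph n) where

  Connected : Set
  Connected = IsConnected (λ _ → ⊤) (Adj G)

  InducedForest : Subset n → Set
  InducedForest X = IsAcyclic (_∈ X) (Adj G)

  MaxInducedForest : Subset n → Set
  MaxInducedForest F = InducedForest F × (∀ X → InducedForest X → ∣ X ∣ ≤ ∣ F ∣)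

  -- c : Fin n → Fin k labels the connected components (trees) of G[F]
  -- bijectively by Fin k: two vertices of F get the same label iff they
  -- lie in the same component of G[F], and every label is used by some
  -- vertex of F.  (Labels of vertices outside F are irrelevant.)
  IsComponentLabelling : (F : Subset n) (k : ℕ) → (Fin n → Fin k) → Set
  IsComponentLabelling F k c =
    (∀ u v → u ∈ F → v ∈ F →
       (c u ≡ c v → Walk (_∈ F) (Adj G) u v) × (Walk (_∈ F) (Adj G) u v → c u ≡ c v))
    × (∀ t → ∃ λ w → w ∈ F × c w ≡ t)

sumFin : ∀ {m} → (Fin m → ℕ) → ℕ
sumFin {zero}  f = 0
sumFin {suc m} f = f zero + sumFin (λ i → f (suc i))

count : ∀ {m} → (Fin m → Bool) → ℕ
count {zero}  f = 0
count {suc m} f = (if f zero then 1 else 0) + count (λ i → f (suc i))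

-- The auxiliary graph H.  Its vertex set is represented inside
-- Fin n ⊎ Fin k: inj₁ u stands for u ∈ S = V ∖ F, inj₂ t stands for x_T
-- where T is the tree with label t.

HV : ℕ → ℕ → Set
HV n k = Fin n ⊎ Fin k

module _ {n : ℕ} (G : Graph n) (F : Subset n) {k : ℕ} (c : Fin n → Fin k) where

  HVertex : HV n k → Set
  HVertex (inj₁ u) = u ∉ F
  HVertex (inj₂ t) = ⊤

  HAdj : HV n k → HV n k → Set
  HAdj (inj₁ u) (inj₁ v) = u ∉ F × v ∉ F × Adj G u v
  HAdj (inj₁ u) (inj₂ t) = u ∉ F × (∃ λ w → w ∈ F × c w ≡ t × Adj G u w)
  HAdj (inj₂ t) (inj₁ u) = u ∉ F × (∃ λ w → w ∈ F × c w ≡ t × Adj G u w)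
  HAdj (inj₂ t) (inj₂ s) = ⊥

  edgesTo : Fin n → Fin k → ℕ
  edgesTo u t = count (λ w → ⌊ w ∈? F ⌋ ∧ (⌊ c w ≟ᶠ t ⌋ ∧ ⌊ adj? G u w ⌋))

  TwoEdge : Fin n → Fin k → Set
  TwoEdge u t = 2 ≤ edgesTo u t

  IsSpanningTree : (HV n k → HV n k → Bool) → Set
  IsSpanningTree B =
    (∀ x y → B x y ≡ B y x)
    × (∀ x y → B x y ≡ true → HAdj x y)
    × IsTree HVertex (λ x y → B x y ≡ true)

  -- number of 2-edges of B (each edge u x_T counted once)
  twoEdgeCount : (HV n k → HV n k → Bool) → ℕ
  twoEdgeCount B =
    sumFin (λ u → count (λ t → B (inj₁ u) (inj₂ t) ∧ ⌊ 2 ≤? edgesTo u t ⌋))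

module Submission where

-- The proof has two halves.
--   * Since F is a maximum induced forest, G[F ∪ {u}] contains a cycle.  It
--     must pass through u, so u has two distinct neighbours in F joined inside
--     F; they lie in one tree T, and u x_T is a 2-edge of H.
--   * If u x_T is not in B, let u–Y be the first edge of the B-path from u to
--     x_T, and exchange it for u x_T.  The result is again a spanning tree of H.
--     Unless u–Y is itself a 2-edge it has more 2-edges than B, contradicting
--     the optimality of B; so u–Y is a 2-edge of B at u.

open import Defs renaming (sym to adj-sym)
open import Data.Nat using (ℕ; zero; suc; _+_; _≤_; _<_; z≤n; s≤s; _≤?_)
open import Data.Nat.Properties using (≤-refl; ≤-trans; m≤n+m; +-mono-≤; +-mono-≤-<; +-mono-<-≤; +-comm; <⇒≱)
open import Data.Bool using (Bool; true; false; if_then_else_; _∧_)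
open import Data.Empty using (⊥; ⊥-elim)
open import Data.Unit using (tt)
open import Data.Product using (Σ; ∃; _×_; _,_; proj₁; proj₂)
open import Data.Sum using (_⊎_; inj₁; inj₂)
open import Data.Sum.Properties using (≡-dec)
open import Data.Fin using (Fin; zero; suc) renaming (_≟_ to _≟ᶠ_)
import Data.Fin.Properties as FinP
open import Data.Fin.Subset using (Subset; _∈_; _∉_; ∣_∣; _∪_; ⁅_⁆)
open import Data.Fin.Subset.Properties using (_∈?_; p⊆p∪q; q⊆p∪q; x∈⁅x⁆; x∈p∪q⁻; x∈⁅y⁆⇒x≡y; p⊂q⇒∣p∣<∣q∣)
open import Data.List using (List; []; _∷_; _++_; length; [_])
open import Data.List.Properties using (++-assoc; ++-identityʳ; length-++)
open import Data.List.Membership.Propositional using () renaming (_∈_ to _∈ₗ_)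
open import Data.List.Membership.Propositional.Properties using (∈-∃++)
open import Data.List.Relation.Unary.All as All using (All; []; _∷_)
open import Data.List.Relation.Unary.All.Properties using (¬Any⇒All¬; ++⁺)
open import Data.List.Relation.Unary.Any using (here; there; any?)
open import Data.List.Relation.Unary.AllPairs using ([]; _∷_)
open import Data.List.Relation.Unary.Linked using (Linked; []; [-]; _∷_)
open import Data.List.Relation.Unary.Unique.Propositional using (Unique)
import Data.List.Relation.Unary.Unique.Propositional.Properties as Unique
open import Function.Bundles using (_⇔_; mk⇔; Equivalence)
open import Relation.Nullary using (¬_; Dec; yes; no; _×-dec_; _⊎-dec_)
open import Relation.Nullary.Decidable using (⌊_⌋; decidable-stable)
open import Relation.Binary using (Symmetric; DecidableEquality)
open import Relation.Binary.PropositionalEquality using (_≡_; _≢_; refl; sym; trans; subst; subst₂; cong; cong₂)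

_∖_ : {V : Set} → (V → Set) → V → V → Set
(P ∖ u) x = P x × u ≢ x

module Walks {V : Set} {P : V → Set} {R : V → V → Set} where

  source : ∀ {a b} → Walk P R a b → P a
  source (here p)     = p
  source (step p _ _) = p

  target : ∀ {a b} → Walk P R a b → P b
  target (here p)     = p
  target (step _ _ w) = target w

  _++ʷ_ : ∀ {a b c} → Walk P R a b → Walk P R b c → Walk P R a c
  here _     ++ʷ w′ = w′
  step p r w ++ʷ w′ = step p r (w ++ʷ w′)

  reverse : Symmetric R → ∀ {a b} → Walk P R a b → Walk P R b a
  reverse sym-R (here p)     = here p
  reverse sym-R (step p r w) = reverse sym-R w ++ʷ step (source w) (sym-R r) (here p)

  vertices : ∀ {a b} → Walk P R a b → List V
  vertices (here {v} _)     = [ v ]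
  vertices (step {u} _ _ w) = u ∷ vertices w

  vertices-inside : ∀ {a b} (w : Walk P R a b) → All P (vertices w)
  vertices-inside (here p)     = p ∷ []
  vertices-inside (step p _ w) = p ∷ vertices-inside w

  vertices-nonempty : ∀ {a b} (w : Walk P R a b) → 1 ≤ length (vertices w)
  vertices-nonempty (here _)     = s≤s z≤n
  vertices-nonempty (step _ _ _) = s≤s z≤n

  vertices-linked : ∀ {a b c} (w : Walk P R a b) → R b c → Linked R (vertices w ++ [ c ])
  vertices-linked (here _)                 r′ = r′ ∷ [-]
  vertices-linked (step _ r (here _))      r′ = r ∷ r′ ∷ [-]
  vertices-linked (step _ r w@(step _ _ _)) r′ = r ∷ vertices-linked w r′

  avoiding : ∀ {u a b} (w : Walk P R a b) → All (u ≢_) (vertices w) → Walk (P ∖ u) R a b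
  avoiding (here p)     (n ∷ [])  = here (p , n)
  avoiding (step p r w) (n ∷ ns)  = step (p , n) r (avoiding w ns)

open Walks

mapʷ : ∀ {V : Set} {P P′ : V → Set} {R R′ : V → V → Set}
     → (∀ {x} → P x → P′ x) → (∀ {x y} → P x → P y → R x y → R′ x y)
     → ∀ {a b} → Walk P R a b → Walk P′ R′ a b
mapʷ f g (here p)     = here (f p)
mapʷ f g (step p r w) = step (f p) (g p (source w) r) (mapʷ f g w)

bindʷ : ∀ {V : Set} {P : V → Set} {R R′ : V → V → Set}
      → (∀ {x y} → P x → P y → R x y → Walk P R′ x y)
      → ∀ {a b} → Walk P R a b → Walk P R′ a b
bindʷ f (here p)     = here p
bindʷ f (step p r w) = f p (source w) r ++ʷ bindʷ f w

Path : {V : Set} → (V → Set) → (V → V → Set) → V → V → Set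
Path P R a b = Σ (Walk P R a b) (λ w → Unique (vertices w))

-- A detour at u: two distinct neighbours of u joined by a walk avoiding u,
-- i.e. a cycle through u presented from u's point of view.
record Detour {V : Set} (P : V → Set) (R : V → V → Set) (u : V) : Set where
  field
    centre    : P u
    left      : V
    right     : V
    toLeft    : R u left
    fromRight : R right u
    distinct  : left ≢ right
    around    : Walk (P ∖ u) R left right

mapᶜ : ∀ {V : Set} {P P′ : V → Set} {R R′ : V → V → Set}
     → (∀ {x} → P x → P′ x) → (∀ {x y} → P x → P y → R x y → R′ x y)
     → Cycle P R → Cycle P′ R′
mapᶜ {P = P} {R = R} {R′ = R′} f g cy = record
  { start    = start
  ; rest     = rest
  ; long     = long
  ; distinct = distinct
  ; inside   = All.map f inside
  ; closed   = linked-map (++⁺ inside (All.head inside ∷ [])) closed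
  }
  where
  open Cycle cy
  linked-map : ∀ {xs} → All P xs → Linked R xs → Linked R′ xs
  linked-map []           []      = []
  linked-map (_ ∷ [])     [-]     = [-]
  linked-map (p ∷ p′ ∷ ps) (r ∷ l) = g p p′ r ∷ linked-map (p′ ∷ ps) l

module Cycles {V : Set} (_≟_ : DecidableEquality V) where

  private variable
    P : V → Set
    R : V → V → Set

  suffixFrom : ∀ {x a b} (w : Walk P R a b) → Unique (vertices w) → x ∈ₗ vertices w → Path P R x b
  suffixFrom w@(here _)     uq       (here refl) = w , uq
  suffixFrom w@(step _ _ _) uq       (here refl) = w , uq
  suffixFrom (here _)       _        (there ())
  suffixFrom (step _ _ w)   (_ ∷ uq) (there m)   = suffixFrom w uq m

  -- every walk can be shortened to a path by cutting out closed subwalks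
  shorten : ∀ {a b} → Walk P R a b → Path P R a b
  shorten (here p) = here p , [] ∷ []
  shorten {a = a} (step p r w) with shorten w
  ... | w′ , uq with any? (a ≟_) (vertices w′)
  ...   | yes a∈w′ = suffixFrom w′ uq a∈w′
  ...   | no  a∉w′ = step p r w′ , ¬Any⇒All¬ _ a∉w′ ∷ uq

  firstEdge : ∀ {a b} (w : Walk P R a b) → Unique (vertices w) → a ≢ b
            → ∃ λ y → R a y × Walk (P ∖ a) R y b
  firstEdge (here _)     _        a≢b = ⊥-elim (a≢b refl)
  firstEdge (step _ r w) (a∉ ∷ _) _   = _ , r , avoiding w a∉

  detour⇒cycle : ∀ {u} → Detour P R u → Cycle P R
  detour⇒cycle {P = P} {R = R} {u = u} d = close (proj₁ path) (proj₂ path) distinct toLeft fromRight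
    where
    open Detour d
    path = shorten around
    close : ∀ {a b} (w : Walk (P ∖ u) R a b) → Unique (vertices w) → a ≢ b → R u a → R b u → Cycle P R
    close (here _)            _  a≢b _ _ = ⊥-elim (a≢b refl)
    close w@(step _ _ w′) uq _ ra rb = record
      { start    = u
      ; rest     = vertices w
      ; long     = s≤s (vertices-nonempty w′)
      ; distinct = All.map proj₂ (vertices-inside w) ∷ uq
      ; inside   = centre ∷ All.map proj₁ (vertices-inside w)
      ; closed   = ra ∷ vertices-linked w rb
      }

  acyclic⇒noDetour : IsAcyclic P R → ∀ {u} → ¬ Detour P R u
  acyclic⇒noDetour acyclic d = acyclic (detour⇒cycle d)

  Closed : (V → Set) → (V → V → Set) → List V → Set
  Closed P R []       = ⊥
  Closed P R (x ∷ xs) = 2 ≤ length xs × Unique (x ∷ xs) × All P (x ∷ xs) × Linked R (x ∷ xs ++ [ x ])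

  rotate : ∀ x zs → Closed P R (x ∷ zs) → Closed P R (zs ++ [ x ])
  rotate {R = R} x (y ∷ ys) (long , (x∉ys ∷ uq) , (px ∷ ps) , (rxy ∷ l)) =
    long′ , Unique.++⁺ uq ([] ∷ []) disjoint , ++⁺ ps (px ∷ []) , snoc (y ∷ ys) l rxy
    where
    long′ : 2 ≤ length (ys ++ [ x ])
    long′ = subst (2 ≤_) (sym (trans (length-++ ys) (+-comm (length ys) 1))) long
    disjoint : ∀ {v} → ¬ (v ∈ₗ y ∷ ys × v ∈ₗ [ x ])
    disjoint (v∈ys , here refl) = All.lookup x∉ys v∈ys refl
    snoc : ∀ ws {a b} → Linked R (ws ++ [ a ]) → R a b → Linked R ((ws ++ [ a ]) ++ [ b ])
    snoc []                 [-]      r = r ∷ [-]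
    snoc (_ ∷ [])           (r′ ∷ [-]) r = r′ ∷ r ∷ [-]
    snoc (_ ∷ w′ ∷ ws)      (r′ ∷ l) r = r′ ∷ snoc (w′ ∷ ws) l r

  rotateTo : ∀ u pre suf → Closed P R (pre ++ u ∷ suf) → Closed P R (u ∷ suf ++ pre)
  rotateTo u []        suf c = subst (λ l → Closed _ _ (u ∷ l)) (sym (++-identityʳ suf)) c
  rotateTo {P = P} {R = R} u (p ∷ pre) suf c =
    subst (λ l → Closed P R (u ∷ l)) (++-assoc suf [ p ] pre)
      (rotateTo u pre (suf ++ [ p ])
        (subst (Closed P R) (++-assoc pre (u ∷ suf) [ p ]) (rotate p (pre ++ u ∷ suf) c)))

  walkAlong : ∀ {Q : V → Set} x xs {z} → All Q (x ∷ xs) → Linked R (x ∷ xs ++ [ z ])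
            → ∃ λ p → p ∈ₗ x ∷ xs × R p z × Walk Q R x p
  walkAlong x []       (q ∷ [])  (r ∷ [-]) = x , here refl , r , here q
  walkAlong x (y ∷ ys) (q ∷ qs) (r ∷ l) with walkAlong y ys qs l
  ... | p , p∈ys , rp , w = p , there p∈ys , rp , step q r w

  detourAtStart : ∀ u zs → Closed P R (u ∷ zs) → Detour P R u
  detourAtStart u (v ∷ w ∷ ws) (_ , (u∉ ∷ v∉ ∷ _) , (pu ∷ pv ∷ ps) , (ruv ∷ rvw ∷ l))
    with walkAlong w ws (All.zip (ps , All.tail u∉)) l
  ... | p , p∈ , rpu , walk = record
    { centre = pu ; left = v ; right = p ; toLeft = ruv ; fromRight = rpu
    ; distinct = All.lookup v∉ p∈ ; around = step (pv , All.head u∉) rvw walk }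
  detourAtStart u (_ ∷ []) (s≤s () , _)

  splitCycle : Cycle P R → ∀ u → Cycle (P ∖ u) R ⊎ Detour P R u
  splitCycle {P = P} {R = R} cy u with any? (u ≟_) (start ∷ rest)
    where open Cycle cy
  ... | no u∉ = inj₁ record
    { start = start ; rest = rest ; long = long ; distinct = distinct
    ; inside = All.zip (inside , ¬Any⇒All¬ _ u∉) ; closed = closed }
    where open Cycle cy
  ... | yes u∈ with ∈-∃++ u∈
  ...   | pre , suf , eq = inj₂ (detourAtStart u (suf ++ pre) (rotateTo u pre suf (subst (Closed P R) eq closedList)))
    where
    open Cycle cy
    closedList : Closed P R (start ∷ rest)
    closedList = long , distinct , inside , closed

override : {A C : Set} → Dec A → Dec C → Bool → Bool
override (yes _) _       b = true
override (no _)  (yes _) b = false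
override (no _)  (no _)  b = b

override-⇔ : {A A′ C C′ : Set} → A ⇔ A′ → C ⇔ C′
           → (a : Dec A) (a′ : Dec A′) (c : Dec C) (c′ : Dec C′) (b : Bool)
           → override a c b ≡ override a′ c′ b
override-⇔ _   _   (yes _) (yes _)  _       _        _ = refl
override-⇔ A⇔A′ _  (yes a) (no ¬a′) _       _        _ = ⊥-elim (¬a′ (Equivalence.to A⇔A′ a))
override-⇔ A⇔A′ _  (no ¬a) (yes a′) _       _        _ = ⊥-elim (¬a (Equivalence.from A⇔A′ a′))
override-⇔ _   _   (no _)  (no _)   (yes _) (yes _)  _ = refl
override-⇔ _ C⇔C′ (no _)  (no _)   (yes c) (no ¬c′) _ = ⊥-elim (¬c′ (Equivalence.to C⇔C′ c))
override-⇔ _ C⇔C′ (no _)  (no _)   (no ¬c) (yes c′) _ = ⊥-elim (¬c (Equivalence.from C⇔C′ c′))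
override-⇔ _   _   (no _)  (no _)   (no _)  (no _)   _ = refl

IsEdge : {V : Set} → V → V → V → V → Set
IsEdge a b x y = (x ≡ a × y ≡ b) ⊎ (x ≡ b × y ≡ a)

isEdge-swap : ∀ {V : Set} {a b x y : V} → IsEdge a b x y → IsEdge a b y x
isEdge-swap (inj₁ (x≡a , y≡b)) = inj₂ (y≡b , x≡a)
isEdge-swap (inj₂ (x≡b , y≡a)) = inj₁ (y≡a , x≡b)

module EdgeExchange {V : Set} (_≟_ : DecidableEquality V) {P : V → Set}
  (B : V → V → Bool) (B-sym : ∀ x y → B x y ≡ B y x) (B-tree : IsTree P (λ x y → B x y ≡ true))
  {U X : V} (PU : P U) (PX : P X) (U≢X : U ≢ X) where

  open Cycles _≟_

  E : V → V → Set
  E x y = B x y ≡ true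

  E-sym : Symmetric E
  E-sym {x} {y} e = trans (B-sym y x) e

  isEdge? : ∀ a b x y → Dec (IsEdge a b x y)
  isEdge? a b x y = ((x ≟ a) ×-dec (y ≟ b)) ⊎-dec ((x ≟ b) ×-dec (y ≟ a))

  private
    pathUX : Path P E U X
    pathUX = shorten (proj₁ B-tree U X PU PX)

    first : ∃ λ y → E U y × Walk (P ∖ U) E y X
    first = firstEdge (proj₁ pathUX) (proj₂ pathUX) U≢X

  Y : V
  Y = proj₁ first

  U–Y : E U Y
  U–Y = proj₁ (proj₂ first)

  Y⇝X : Walk (P ∖ U) E Y X
  Y⇝X = proj₂ (proj₂ first)

  exchanged : V → V → Bool
  exchanged x y = override (isEdge? U X x y) (isEdge? U Y x y) (B x y)

  E′ : V → V → Set
  E′ x y = exchanged x y ≡ true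

  exchanged-sym : ∀ x y → exchanged x y ≡ exchanged y x
  exchanged-sym x y rewrite B-sym x y =
    override-⇔ swap swap (isEdge? U X x y) (isEdge? U X y x) (isEdge? U Y x y) (isEdge? U Y y x) (B y x)
    where
    swap : ∀ {a b} → IsEdge a b x y ⇔ IsEdge a b y x
    swap = mk⇔ isEdge-swap isEdge-swap

  E′-sym : Symmetric E′
  E′-sym {x} {y} e = trans (exchanged-sym y x) e

  exchanged-edge : ∀ {x y} → E′ x y → IsEdge U X x y ⊎ (¬ IsEdge U Y x y × E x y)
  exchanged-edge {x} {y} e with isEdge? U X x y
  ... | yes UX = inj₁ UX
  ... | no _ with isEdge? U Y x y
  ...   | no ¬UY = inj₂ (¬UY , e)   -- if U–Y were meant, e would be false ≡ true

  exchanged-new : E′ U X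
  exchanged-new with isEdge? U X U X
  ... | yes _  = refl
  ... | no ¬UX = ⊥-elim (¬UX (inj₁ (refl , refl)))

  exchanged-keep : ∀ {x y} → E x y → ¬ IsEdge U Y x y → E′ x y
  exchanged-keep {x} {y} e ¬UY with isEdge? U X x y
  ... | yes _ = refl
  ... | no _ with isEdge? U Y x y
  ...   | yes UY = ⊥-elim (¬UY UY)
  ...   | no _   = e

  exchanged-off : ∀ {x y} → U ≢ x → U ≢ y → E′ x y → E x y
  exchanged-off U≢x U≢y e with exchanged-edge e
  ... | inj₁ (inj₁ (x≡U , _)) = ⊥-elim (U≢x (sym x≡U))
  ... | inj₁ (inj₂ (_ , y≡U)) = ⊥-elim (U≢y (sym y≡U))
  ... | inj₂ (_ , e′)         = e′

  exchanged-on : ∀ {x y} → U ≢ x → U ≢ y → E x y → E′ x y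
  exchanged-on U≢x U≢y e = exchanged-keep e λ
    { (inj₁ (x≡U , _)) → U≢x (sym x≡U)
    ; (inj₂ (_ , y≡U)) → U≢y (sym y≡U) }

  exchanged-neighbour : ∀ {z} → E′ U z → z ≡ X ⊎ (z ≢ Y × E U z)
  exchanged-neighbour e with exchanged-edge e
  ... | inj₁ (inj₁ (_ , z≡X))  = inj₁ z≡X
  ... | inj₁ (inj₂ (U≡X , _))  = ⊥-elim (U≢X U≡X)
  ... | inj₂ (¬UY , e′)        = inj₂ ((λ z≡Y → ¬UY (inj₁ (refl , z≡Y))) , e′)

  keepWalk : ∀ {a b} → Walk (P ∖ U) E a b → Walk (P ∖ U) E′ a b
  keepWalk = mapʷ (λ p → p) (λ (_ , U≢x) (_ , U≢y) → exchanged-on U≢x U≢y)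

  loseWalk : ∀ {a b} → Walk (P ∖ U) E′ a b → Walk (P ∖ U) E a b
  loseWalk = mapʷ (λ p → p) (λ (_ , U≢x) (_ , U≢y) → exchanged-off U≢x U≢y)

  -- the removed edge U–Y is replaced by the route U–X ⇝ Y
  U⇝Y : Walk P E′ U Y
  U⇝Y = step PU exchanged-new (mapʷ proj₁ (λ _ _ e → e) (keepWalk (reverse E-sym Y⇝X)))

  exchanged-connected : IsConnected P E′
  exchanged-connected a b pa pb = bindʷ replaceEdge (proj₁ B-tree a b pa pb)
    where
    replaceEdge : ∀ {x y} → P x → P y → E x y → Walk P E′ x y
    replaceEdge {x} {y} px py e with isEdge? U Y x y
    ... | no ¬UY                    = step px (exchanged-keep e ¬UY) (here py)
    ... | yes (inj₁ (refl , refl)) = U⇝Y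
    ... | yes (inj₂ (refl , refl)) = reverse E′-sym U⇝Y

  -- a detour at U in the new tree gives one in B: a detour through X
  -- is rerouted along the B-path X ⇝ Y
  pullback : Detour P E′ U → Detour P E U
  pullback record { centre = pU ; left = l ; right = r ; toLeft = Ul ; fromRight = rU
                  ; distinct = l≢r ; around = l⇝r }
    with exchanged-neighbour Ul | exchanged-neighbour (E′-sym rU)
  ... | inj₁ refl        | inj₁ refl       = ⊥-elim (l≢r refl)
  ... | inj₁ refl        | inj₂ (r≢Y , Ur) = record
    { centre = pU ; left = Y ; right = r ; toLeft = U–Y ; fromRight = E-sym Ur
    ; distinct = λ Y≡r → r≢Y (sym Y≡r) ; around = Y⇝X ++ʷ loseWalk l⇝r }
  ... | inj₂ (l≢Y , Ul′) | inj₁ refl       = record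
    { centre = pU ; left = l ; right = Y ; toLeft = Ul′ ; fromRight = E-sym U–Y
    ; distinct = l≢Y ; around = loseWalk l⇝r ++ʷ reverse E-sym Y⇝X }
  ... | inj₂ (_ , Ul′)   | inj₂ (_ , Ur)   = record
    { centre = pU ; left = l ; right = r ; toLeft = Ul′ ; fromRight = E-sym Ur
    ; distinct = l≢r ; around = loseWalk l⇝r }

  exchanged-acyclic : IsAcyclic P E′
  exchanged-acyclic cy with splitCycle cy U
  ... | inj₁ cy′ = proj₂ B-tree (mapᶜ proj₁ (λ (_ , U≢x) (_ , U≢y) → exchanged-off U≢x U≢y) cy′)
  ... | inj₂ d   = acyclic⇒noDetour (proj₂ B-tree) (pullback d)

  exchanged-tree : IsTree P E′
  exchanged-tree = exchanged-connected , exchanged-acyclic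

indicator : Bool → ℕ
indicator b = if b then 1 else 0

count≡sum : ∀ {m} (f : Fin m → Bool) → count f ≡ sumFin (λ i → indicator (f i))
count≡sum {zero}  f = refl
count≡sum {suc m} f = cong (indicator (f zero) +_) (count≡sum (λ i → f (suc i)))

sumFin-mono : ∀ {m} {f g : Fin m → ℕ} → (∀ i → f i ≤ g i) → sumFin f ≤ sumFin g
sumFin-mono {zero}  f≤g = z≤n
sumFin-mono {suc m} f≤g = +-mono-≤ (f≤g zero) (sumFin-mono (λ i → f≤g (suc i)))

sumFin-strict : ∀ {m} {f g : Fin m → ℕ} → (∀ i → f i ≤ g i) → ∀ j → f j < g j → sumFin f < sumFin g
sumFin-strict f≤g zero    fj<gj = +-mono-<-≤ fj<gj (sumFin-mono (λ i → f≤g (suc i)))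
sumFin-strict f≤g (suc j) fj<gj = +-mono-≤-< (f≤g zero) (sumFin-strict (λ i → f≤g (suc i)) j fj<gj)

indicator-mono : ∀ {a b} → (a ≡ true → b ≡ true) → indicator a ≤ indicator b
indicator-mono {false} {false} _   = z≤n
indicator-mono {false} {true}  _   = z≤n
indicator-mono {true}          a⇒b rewrite a⇒b refl = ≤-refl

count-mono : ∀ {m} {f g : Fin m → Bool} → (∀ i → f i ≡ true → g i ≡ true) → count f ≤ count g
count-mono {f = f} {g} f⇒g =
  subst₂ _≤_ (sym (count≡sum f)) (sym (count≡sum g)) (sumFin-mono (λ i → indicator-mono (f⇒g i)))

count-strict : ∀ {m} {f g : Fin m → Bool} → (∀ i → f i ≡ true → g i ≡ true)
             → ∀ j → f j ≡ false → g j ≡ true → count f < count g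
count-strict {f = f} {g} f⇒g j fj gj =
  subst₂ _<_ (sym (count≡sum f)) (sym (count≡sum g))
    (sumFin-strict (λ i → indicator-mono (f⇒g i)) j (subst₂ (λ a b → indicator a < indicator b) (sym fj) (sym gj) ≤-refl))

count-positive : ∀ {m} (f : Fin m → Bool) i → f i ≡ true → 1 ≤ count f
count-positive f zero    fi rewrite fi = s≤s z≤n
count-positive f (suc i) fi = ≤-trans (count-positive (λ j → f (suc j)) i fi) (m≤n+m _ (indicator (f zero)))

count-two : ∀ {m} (f : Fin m → Bool) i j → f i ≡ true → f j ≡ true → i ≢ j → 2 ≤ count f
count-two f zero    zero    _  _  i≢j = ⊥-elim (i≢j refl)
count-two f zero    (suc j) fi fj _   rewrite fi = s≤s (count-positive (λ x → f (suc x)) j fj)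
count-two f (suc i) zero    fi fj _   rewrite fj = s≤s (count-positive (λ x → f (suc x)) i fi)
count-two f (suc i) (suc j) fi fj i≢j =
  ≤-trans (count-two (λ x → f (suc x)) i j fi fj (λ i≡j → i≢j (cong suc i≡j))) (m≤n+m _ (indicator (f zero)))

count-witness : ∀ {m} (f : Fin m → Bool) → 1 ≤ count f → ∃ λ i → f i ≡ true
count-witness {suc m} f pos with f zero in f0
... | true  = zero , f0
... | false with count-witness (λ i → f (suc i)) pos
...   | i , fi = suc i , fi

∧-true : ∀ {a b} → a ∧ b ≡ true → a ≡ true × b ≡ true
∧-true {true} b≡true = refl , b≡true

isYes-true : ∀ {A : Set} (d : Dec A) → A → ⌊ d ⌋ ≡ true
isYes-true (yes _) _ = refl
isYes-true (no ¬a) a = ⊥-elim (¬a a)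

isYes-sound : ∀ {A : Set} (d : Dec A) → ⌊ d ⌋ ≡ true → A
isYes-sound (yes a) _ = a

module Components {n : ℕ} (G : Graph n) (F : Subset n) {k : ℕ} (c : Fin n → Fin k) where

  open Cycles (_≟ᶠ_ {n})

  seesVia : Fin n → Fin k → Fin n → Bool
  seesVia u t w = ⌊ w ∈? F ⌋ ∧ (⌊ c w ≟ᶠ t ⌋ ∧ ⌊ adj? G u w ⌋)

  seesVia-true : ∀ {u t w} → w ∈ F → c w ≡ t → Adj G u w → seesVia u t w ≡ true
  seesVia-true {u} {t} {w} w∈F cw≡t uw
    rewrite isYes-true (w ∈? F) w∈F | isYes-true (c w ≟ᶠ t) cw≡t | isYes-true (adj? G u w) uw = refl

  twoEdge⇒edge : ∀ {u t} → u ∉ F → TwoEdge G F c u t → HAdj G F c (inj₁ u) (inj₂ t)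
  twoEdge⇒edge {u} {t} u∉F two with count-witness (seesVia u t) (≤-trans (s≤s z≤n) two)
  ... | w , sees with ∧-true sees
  ...   | w∈F , rest with ∧-true rest
  ...     | cw≡t , uw = u∉F , w , isYes-sound (w ∈? F) w∈F , isYes-sound (c w ≟ᶠ t) cw≡t , isYes-sound (adj? G u w) uw

  sameTree⇒twoEdge : IsComponentLabelling G F k c → ∀ {u p q} → p ≢ q → Adj G u p → Adj G u q
                   → Walk (_∈ F) (Adj G) p q → TwoEdge G F c u (c p)
  sameTree⇒twoEdge labelling {u} {p} {q} p≢q up uq p⇝q =
    count-two (seesVia u (c p)) p q (seesVia-true p∈F refl up) (seesVia-true q∈F (sym cp≡cq) uq) p≢q
    where
    p∈F = source p⇝q
    q∈F = target p⇝q
    cp≡cq = proj₂ (proj₁ labelling p q p∈F q∈F) p⇝q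

  module _ (maxForest : MaxInducedForest G F) (labelling : IsComponentLabelling G F k c)
           {u : Fin n} (u∉F : u ∉ F) where

    F+u : Subset n
    F+u = F ∪ ⁅ u ⁆

    -- G[F ∪ {u}] is larger than the maximum induced forest G[F]
    F+u-notForest : ¬ InducedForest G F+u
    F+u-notForest isForest = <⇒≱ F<F+u (proj₂ maxForest F+u isForest)
      where
      F<F+u : ∣ F ∣ < ∣ F+u ∣
      F<F+u = p⊂q⇒∣p∣<∣q∣ (p⊆p∪q {p = F} ⁅ u ⁆ , u , q⊆p∪q F ⁅ u ⁆ (x∈⁅x⁆ u) , u∉F)

    inF : ∀ {x} → ((_∈ F+u) ∖ u) x → x ∈ F
    inF {x} (x∈F+u , u≢x) with x∈p∪q⁻ F ⁅ u ⁆ x∈F+u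
    ... | inj₁ x∈F = x∈F
    ... | inj₂ x∈u = ⊥-elim (u≢x (sym (x∈⁅y⁆⇒x≡y u x∈u)))

    -- a cycle in G[F ∪ {u}] must pass through u, and its two edges at u go to the same tree
    cycle⇒twoEdge : Cycle (_∈ F+u) (Adj G) → ∃ λ t → TwoEdge G F c u t
    cycle⇒twoEdge cy with splitCycle cy u
    ... | inj₁ cy′ = ⊥-elim (proj₁ maxForest (mapᶜ inF (λ _ _ e → e) cy′))
    ... | inj₂ d   = c left , sameTree⇒twoEdge labelling distinct toLeft (adj-sym G fromRight) (mapʷ inF (λ _ _ e → e) around)
      where open Detour d

    maximal⇒twoEdge : ∃ λ t → TwoEdge G F c u t
    maximal⇒twoEdge = decidable-stable (FinP.any? λ t → 2 ≤? edgesTo G F c u t)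
                        (λ noTwoEdge → F+u-notForest (λ cy → noTwoEdge (cycle⇒twoEdge cy)))

  twoEdgeTable : (HV n k → HV n k → Bool) → Fin n → Fin k → Bool
  twoEdgeTable B a t = B (inj₁ a) (inj₂ t) ∧ ⌊ 2 ≤? edgesTo G F c a t ⌋

  twoEdgeCount-strict : ∀ B₁ B₂ → (∀ a t → twoEdgeTable B₁ a t ≡ true → twoEdgeTable B₂ a t ≡ true)
    → ∀ a t → twoEdgeTable B₁ a t ≡ false → twoEdgeTable B₂ a t ≡ true
    → twoEdgeCount G F c B₁ < twoEdgeCount G F c B₂
  twoEdgeCount-strict B₁ B₂ more a t old new =
    sumFin-strict (λ a′ → count-mono (more a′)) a (count-strict (more a) t old new)

module OptimalTree {n : ℕ} (G : Graph n) (F : Subset n) {k : ℕ} (c : Fin n → Fin k)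
  (B : HV n k → HV n k → Bool) (spanning : IsSpanningTree G F c B)
  (optimal : ∀ B′ → IsSpanningTree G F c B′ → twoEdgeCount G F c B′ ≤ twoEdgeCount G F c B)
  {u : Fin n} (u∉F : u ∉ F) where

  open Components G F c using (twoEdge⇒edge; twoEdgeTable; twoEdgeCount-strict)

  _≟H_ : DecidableEquality (HV n k)
  _≟H_ = ≡-dec _≟ᶠ_ _≟ᶠ_

  TwoEdgeInB : Set
  TwoEdgeInB = ∃ λ t → B (inj₁ u) (inj₂ t) ≡ true × TwoEdge G F c u t

  TwoEdgeTo : HV n k → Set
  TwoEdgeTo (inj₁ _) = ⊥
  TwoEdgeTo (inj₂ t) = TwoEdge G F c u t

  twoEdgeTo? : ∀ x → Dec (TwoEdgeTo x)
  twoEdgeTo? (inj₁ _) = no λ ()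
  twoEdgeTo? (inj₂ t) = 2 ≤? edgesTo G F c u t

  twoEdgeInB : ∀ x → B (inj₁ u) x ≡ true → TwoEdgeTo x → TwoEdgeInB
  twoEdgeInB (inj₂ t) ux two = t , ux , two

  module _ {T : Fin k} (two : TwoEdge G F c u T) (notInB : B (inj₁ u) (inj₂ T) ≡ false) where

    open EdgeExchange _≟H_ B (proj₁ spanning) (proj₂ (proj₂ spanning)) {inj₁ u} {inj₂ T} u∉F tt (λ ())

    -- its new edge u x_T lies in H, so the exchanged tree spans H
    exchanged-spanning : IsSpanningTree G F c exchanged
    exchanged-spanning = exchanged-sym , inH , exchanged-tree
      where
      inH : ∀ x y → E′ x y → HAdj G F c x y
      inH x y e with exchanged-edge e
      ... | inj₁ (inj₁ (refl , refl)) = twoEdge⇒edge u∉F two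
      ... | inj₁ (inj₂ (refl , refl)) = twoEdge⇒edge u∉F two
      ... | inj₂ (_ , e′)             = proj₁ (proj₂ spanning) x y e′

    -- unless the removed edge u–Y is a 2-edge, the exchange gains the 2-edge u x_T
    exchanged-better : ¬ TwoEdgeTo Y → twoEdgeCount G F c B < twoEdgeCount G F c exchanged
    exchanged-better ¬twoY = twoEdgeCount-strict B exchanged kept u T lost gained
      where
      kept : ∀ a t → twoEdgeTable B a t ≡ true → twoEdgeTable exchanged a t ≡ true
      kept a t entry with ∧-true entry
      ... | at , twoAt = cong₂ _∧_ (exchanged-keep at notRemoved) twoAt
        where
        notRemoved : ¬ IsEdge (inj₁ u) Y (inj₁ a) (inj₂ t)
        notRemoved (inj₁ (refl , t≡Y)) = ¬twoY (subst TwoEdgeTo t≡Y (isYes-sound (2 ≤? edgesTo G F c u t) twoAt))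
        notRemoved (inj₂ (_ , ()))
      lost : twoEdgeTable B u T ≡ false
      lost = cong (_∧ _) notInB
      gained : twoEdgeTable exchanged u T ≡ true
      gained = cong₂ _∧_ exchanged-new (isYes-true (2 ≤? edgesTo G F c u T) two)

    removed-twoEdge : TwoEdgeInB
    removed-twoEdge with twoEdgeTo? Y
    ... | yes twoY = twoEdgeInB Y U–Y twoY
    ... | no ¬twoY = ⊥-elim (<⇒≱ (exchanged-better ¬twoY) (optimal exchanged exchanged-spanning))

  optimal⇒twoEdge : ∀ {T} → TwoEdge G F c u T → TwoEdgeInB
  optimal⇒twoEdge {T} two with B (inj₁ u) (inj₂ T) in uT
  ... | true  = T , uT , two
  ... | false = removed-twoEdge two uT

lemma4 : ∀ {n} (G : Graph n) → Connected G
       → (F : Subset n) → MaxInducedForest G F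
       → (k : ℕ) (c : Fin n → Fin k) → IsComponentLabelling G F k c
       → (B : HV n k → HV n k → Bool) → IsSpanningTree G F c B
       → (∀ B′ → IsSpanningTree G F c B′ → twoEdgeCount G F c B′ ≤ twoEdgeCount G F c B)
       → ∀ u → u ∉ F → ∃ λ t → B (inj₁ u) (inj₂ t) ≡ true × TwoEdge G F c u t
lemma4 G _ F maxForest k c labelling B spanning optimal u u∉F =
  OptimalTree.optimal⇒twoEdge G F c B spanning optimal u∉F
    (proj₂ (Components.maximal⇒twoEdge G F c maxForest labelling u∉F))
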